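{- Let $G=(V,E)$ be a graph with minimum degree $\delta(G)$ and let $k$ be an integer with $1-\lceil\delta(G)/2\rceil\le k\le\lfloor\delta(G)/2\rfloor$. If there is a partition $\{S_1,\ldots,S_r\}$ of $V$ with $r\ge2$ such that every $S_i$ is a $k$-monopoly in $G$, then $r\le 2-2k$ and $k\le0$.
   Context: All graphs are finite and simple. For a vertex $v$, $\delta(v)$ is its degree and $\delta_X(v)=|N(v)\cap X|$. For an integer $k$ in the stated range, a nonempty set $M\subseteq V$ is a $k$-monopoly if every vertex $v\in V$ satisfies $\delta_M(v)\ge\frac{\delta(v)}{2}+k$. -}

module Defs where

open import Data.Nat using (ℕ; _≤_)
open import Data.Integer as ℤ using (ℤ; +_)
open import Data.Fin using (Fin)
open import Data.Fin.Subset using (Subset; _∈_; _∉_; _∩_; ∣_∣; Nonempty)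
open import Data.Product using (∃; _×_)
open import Relation.Binary.PropositionalEquality using (_≡_)

record Graph (n : ℕ) : Set where
  field
    N         : Fin n → Subset n
    irrefl    : ∀ v → v ∉ N v
    symmetric : ∀ u v → u ∈ N v → v ∈ N u
open Graph public

deg : ∀ {n} → Graph n → Fin n → ℕ
deg G v = ∣ N G v ∣

degIn : ∀ {n} → Graph n → Subset n → Fin n → ℕ
degIn G X v = ∣ N G v ∩ X ∣

IsMinDegree : ∀ {n} → Graph n → ℕ → Set
IsMinDegree G d = (∃ λ v → deg G v ≡ d) × (∀ v → d ≤ deg G v)

-- M is a k-monopoly: M nonempty and δ_M(v) ≥ δ(v)/2 + k for all v,
-- written equivalently (multiplying by 2) as 2 δ_M(v) ≥ δ(v) + 2k in ℤ.
IsMonopoly : ∀ {n} → Graph n → ℤ → Subset n → Set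
IsMonopoly G k M =
  Nonempty M ×
  (∀ v → (+ deg G v) ℤ.+ (+ 2) ℤ.* k ℤ.≤ (+ 2) ℤ.* (+ degIn G M v))

-- Let v have minimum degree d and write k = m - ⌈d/2⌉; the lower bound on k
-- gives m ≥ 1. Since 2⌈d/2⌉ ≤ d + 1, the monopoly inequality at v,
-- 2 δ_{S_i}(v) ≥ d + 2k, forces δ_{S_i}(v) ≥ m by integrality. The classes
-- partition N(v), so r m ≤ d ≤ 2⌈d/2⌉. With r ≥ 2 this gives m ≤ ⌈d/2⌉, i.e.
-- k ≤ 0, and (r - 2)(m - 1) ≥ 0 gives r + 2m ≤ 2 + r m ≤ 2 + 2⌈d/2⌉, i.e.
-- r ≤ 2 - 2k.

module Submission where

open import Defs
open import Data.Nat using (ℕ; ⌊_/2⌋; ⌈_/2⌉) renaming (_≤_ to _≤ℕ_)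
open import Data.Integer using (ℤ; +_; _+_; _-_; _*_; _≤_)
open import Data.Fin using (Fin)
open import Data.Fin.Subset using (Subset)
open import Data.Vec using (tabulate)
open import Data.Product using (_×_)
open import Relation.Binary.PropositionalEquality using (_≡_)
open import Relation.Nullary.Decidable using (⌊_⌋)
open import Data.Fin using (_≟_)
open import Function.Definitions using (Surjective)

import Data.Nat as ℕ
import Data.Nat.Properties as NP
open import Algebra.Properties.CommutativeMonoid.Sum NP.+-0-commutativeMonoid
  using (sum-syntax; sum-cong-≗; sum-replicate-zero)
open import Data.Bool using (true; false)
import Data.Nat.Tactic.RingSolver as ℕSolver
open import Data.Fin using (zero; suc)
open import Data.Fin.Subset using (_∩_; ∣_∣)
open import Data.Integer using (+≤+; -_)
import Data.Integer.Properties as ZP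
open ZP using (pos-+; pos-*; +-monoˡ-≤; drop‿+≤+; i≤j⇒i-j≤0)
open import Data.Integer.Tactic.RingSolver using (solve-∀)
open import Data.Product using (∃-syntax; _,_)
open import Data.Vec using ([]; _∷_)
open import Function using (_∘_)
open import Relation.Binary.PropositionalEquality
  using (refl; sym; cong; trans; subst; subst₂; module ≡-Reasoning)
open import Relation.Nullary.Decidable using (⌊⌋-map′)

fiber : ∀ {n r} → (Fin n → Fin r) → Fin r → Subset n
fiber f i = tabulate (λ v → ⌊ f v ≟ i ⌋)

∑-∣∷∣ : ∀ {r n} (j : Fin r) (xs : Fin r → Subset n) →
        ∑[ i < r ] ∣ ⌊ j ≟ i ⌋ ∷ xs i ∣ ≡ ℕ.suc (∑[ i < r ] ∣ xs i ∣)
∑-∣∷∣ zero    xs = refl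
-- ⌊ suc j ≟ suc i ⌋ is not definitionally ⌊ j ≟ i ⌋, hence ⌊⌋-map′.
∑-∣∷∣ (suc j) xs = begin
  ∣ xs zero ∣ ℕ.+ ∑[ i < _ ] ∣ ⌊ suc j ≟ suc i ⌋ ∷ xs (suc i) ∣
    ≡⟨ cong (∣ xs zero ∣ ℕ.+_) (sum-cong-≗ (λ i → cong (λ b → ∣ b ∷ xs (suc i) ∣) (⌊⌋-map′ _ _ (j ≟ i)))) ⟩
  ∣ xs zero ∣ ℕ.+ ∑[ i < _ ] ∣ ⌊ j ≟ i ⌋ ∷ xs (suc i) ∣
    ≡⟨ cong (∣ xs zero ∣ ℕ.+_) (∑-∣∷∣ j (xs ∘ suc)) ⟩
  ∣ xs zero ∣ ℕ.+ ℕ.suc (∑[ i < _ ] ∣ xs (suc i) ∣)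
    ≡⟨ NP.+-suc _ _ ⟩
  ℕ.suc (∑[ i < _ ] ∣ xs i ∣) ∎
  where open ≡-Reasoning

∑-∣∩fiber∣ : ∀ {n r} (f : Fin n → Fin r) (X : Subset n) → ∑[ i < r ] ∣ X ∩ fiber f i ∣ ≡ ∣ X ∣
∑-∣∩fiber∣ {r = r} f []  = sum-replicate-zero r
∑-∣∩fiber∣ f (false ∷ X) = ∑-∣∩fiber∣ (f ∘ suc) X
∑-∣∩fiber∣ f (true ∷ X)  = trans (∑-∣∷∣ (f zero) (λ i → X ∩ fiber (f ∘ suc) i)) (cong ℕ.suc (∑-∣∩fiber∣ (f ∘ suc) X))

*≤∑ : ∀ {r m} (g : Fin r → ℕ) → (∀ i → m ≤ℕ g i) → r ℕ.* m ≤ℕ ∑[ i < r ] g i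
*≤∑ {ℕ.zero}  g m≤g = ℕ.z≤n
*≤∑ {ℕ.suc r} g m≤g = NP.+-mono-≤ (m≤g zero) (*≤∑ (g ∘ suc) (m≤g ∘ suc))

2*⌈n/2⌉≤1+n : ∀ n → 2 ℕ.* ⌈ n /2⌉ ≤ℕ ℕ.suc n
2*⌈n/2⌉≤1+n n = begin
  2 ℕ.* ⌈ n /2⌉           ≡⟨ cong (⌈ n /2⌉ ℕ.+_) (NP.+-identityʳ _) ⟩
  ⌈ n /2⌉ ℕ.+ ⌈ n /2⌉     ≤⟨ NP.+-monoˡ-≤ ⌈ n /2⌉ (NP.⌊n/2⌋≤⌈n/2⌉ (ℕ.suc n)) ⟩
  ℕ.suc (⌊ n /2⌋ ℕ.+ ⌈ n /2⌉) ≡⟨ cong ℕ.suc (NP.⌊n/2⌋+⌈n/2⌉≡n n) ⟩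
  ℕ.suc n                 ∎
  where open NP.≤-Reasoning

n≤2*⌈n/2⌉ : ∀ n → n ≤ℕ 2 ℕ.* ⌈ n /2⌉
n≤2*⌈n/2⌉ n = begin
  n                        ≡⟨ NP.⌊n/2⌋+⌈n/2⌉≡n n ⟨
  ⌊ n /2⌋ ℕ.+ ⌈ n /2⌉      ≤⟨ NP.+-monoˡ-≤ ⌈ n /2⌉ (NP.⌊n/2⌋≤⌈n/2⌉ n) ⟩
  ⌈ n /2⌉ ℕ.+ ⌈ n /2⌉      ≡⟨ cong (⌈ n /2⌉ ℕ.+_) (NP.+-identityʳ _) ⟨
  2 ℕ.* ⌈ n /2⌉            ∎
  where open NP.≤-Reasoning

2*m≤1+2*n⇒m≤n : ∀ {m n} → 2 ℕ.* m ≤ℕ ℕ.suc (2 ℕ.* n) → m ≤ℕ n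
2*m≤1+2*n⇒m≤n {m} {n} h =
  ℕ.s≤s⁻¹ (NP.*-cancelˡ-< 2 m (ℕ.suc n) (NP.≤-trans (ℕ.s≤s h) (NP.≤-reflexive (sym (NP.*-suc 2 n)))))

r+2*m≤2+r*m : ∀ {r m} → 2 ≤ℕ r → 1 ≤ℕ m → r ℕ.+ 2 ℕ.* m ≤ℕ 2 ℕ.+ r ℕ.* m
r+2*m≤2+r*m {ℕ.suc (ℕ.suc s)} {ℕ.suc t} (ℕ.s≤s (ℕ.s≤s _)) (ℕ.s≤s _) = begin
  ℕ.suc (ℕ.suc s) ℕ.+ 2 ℕ.* ℕ.suc t               ≤⟨ NP.m≤m+n _ (s ℕ.* t) ⟩
  ℕ.suc (ℕ.suc s) ℕ.+ 2 ℕ.* ℕ.suc t ℕ.+ s ℕ.* t  ≡⟨ expand s t ⟩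
  2 ℕ.+ ℕ.suc (ℕ.suc s) ℕ.* ℕ.suc t              ∎
  where
  open NP.≤-Reasoning
  expand : ∀ s t → ℕ.suc (ℕ.suc s) ℕ.+ 2 ℕ.* ℕ.suc t ℕ.+ s ℕ.* t ≡ 2 ℕ.+ ℕ.suc (ℕ.suc s) ℕ.* ℕ.suc t
  expand = ℕSolver.solve-∀

r*m≤2*c⇒m≤c : ∀ {r m} c → 2 ≤ℕ r → r ℕ.* m ≤ℕ 2 ℕ.* c → m ≤ℕ c
r*m≤2*c⇒m≤c {m = m} _ 2≤r r*m≤2*c = NP.*-cancelˡ-≤ 2 (NP.≤-trans (NP.*-monoˡ-≤ m 2≤r) r*m≤2*c)

r*m≤2*c⇒r+2*m≤2+2*c : ∀ {r m} c → 2 ≤ℕ r → 1 ≤ℕ m → r ℕ.* m ≤ℕ 2 ℕ.* c → r ℕ.+ 2 ℕ.* m ≤ℕ 2 ℕ.+ 2 ℕ.* c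
r*m≤2*c⇒r+2*m≤2+2*c _ 2≤r 1≤m r*m≤2*c = NP.≤-trans (r+2*m≤2+r*m 2≤r 1≤m) (NP.+-monoʳ-≤ 2 r*m≤2*c)

pos-+-2* : ∀ a b → + (a ℕ.+ 2 ℕ.* b) ≡ + a + + 2 * + b
pos-+-2* a b = trans (pos-+ a (2 ℕ.* b)) (cong (_+_ (+ a)) (pos-* 2 b))

i-j+j≡i : ∀ i j → i - j + j ≡ i
i-j+j≡i = solve-∀

i≡i+j-j : ∀ i j → i ≡ i + j - j
i≡i+j-j = solve-∀

1-c≤k⇒k≡m-c : ∀ c {k} → + 1 - + c ≤ k → ∃[ m ] 1 ≤ℕ m × k ≡ + m - + c
1-c≤k⇒k≡m-c c {k} 1-c≤k
  with k + + c in k+c≡i | subst (_≤ k + + c) (i-j+j≡i (+ 1) (+ c)) (+-monoˡ-≤ (+ c) 1-c≤k)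
... | + m | +≤+ 1≤m = m , 1≤m , trans (i≡i+j-j k (+ c)) (cong (_- + c) k+c≡i)

+D+2[m-c]≤2δ⇒D+2m≤2δ+2c : ∀ D m c δ → + D + + 2 * (+ m - + c) ≤ + 2 * + δ →
                             D ℕ.+ 2 ℕ.* m ≤ℕ 2 ℕ.* δ ℕ.+ 2 ℕ.* c
+D+2[m-c]≤2δ⇒D+2m≤2δ+2c D m c δ h = drop‿+≤+ (begin
  + (D ℕ.+ 2 ℕ.* m)                      ≡⟨ pos-+-2* D m ⟩
  + D + + 2 * + m                        ≡⟨ x+2y≡x+2[y-z]+2z (+ D) (+ m) (+ c) ⟩
  + D + + 2 * (+ m - + c) + + 2 * + c    ≤⟨ +-monoˡ-≤ (+ 2 * + c) h ⟩
  + 2 * + δ + + 2 * + c                  ≡⟨ cong (_+ + 2 * + c) (pos-* 2 δ) ⟨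
  + (2 ℕ.* δ) + + 2 * + c                ≡⟨ pos-+-2* (2 ℕ.* δ) c ⟨
  + (2 ℕ.* δ ℕ.+ 2 ℕ.* c)                ∎)
  where
  open ZP.≤-Reasoning
  x+2y≡x+2[y-z]+2z : ∀ x y z → x + + 2 * y ≡ x + + 2 * (y - z) + + 2 * z
  x+2y≡x+2[y-z]+2z = solve-∀

r+2m≤2+2c⇒r≤2-2[m-c] : ∀ r m c → r ℕ.+ 2 ℕ.* m ≤ℕ 2 ℕ.+ 2 ℕ.* c → + r ≤ + 2 - + 2 * (+ m - + c)
r+2m≤2+2c⇒r≤2-2[m-c] r m c h = begin
  + r                                  ≡⟨ i≡i+j-j (+ r) (+ 2 * + m) ⟩
  + r + + 2 * + m - + 2 * + m          ≤⟨ +-monoˡ-≤ (- (+ 2 * + m)) (subst₂ _≤_ (pos-+-2* r m) (pos-+-2* 2 c) (+≤+ h)) ⟩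
  + 2 + + 2 * + c - + 2 * + m          ≡⟨ 2+2z-2y≡2-2[y-z] (+ m) (+ c) ⟩
  + 2 - + 2 * (+ m - + c)              ∎
  where
  open ZP.≤-Reasoning
  2+2z-2y≡2-2[y-z] : ∀ y z → + 2 + + 2 * z - + 2 * y ≡ + 2 - + 2 * (y - z)
  2+2z-2y≡2-2[y-z] = solve-∀

monopoly⇒m≤degIn : ∀ {n} (G : Graph n) {d m M} {v : Fin n} →
                   IsMonopoly G (+ m - + ⌈ d /2⌉) M → d ≤ℕ deg G v → m ≤ℕ degIn G M v
monopoly⇒m≤degIn G {d} {m} {M} {v} (_ , bound) d≤D = 2*m≤1+2*n⇒m≤n (NP.+-cancelˡ-≤ D _ _ (begin
  D ℕ.+ 2 ℕ.* m                   ≤⟨ +D+2[m-c]≤2δ⇒D+2m≤2δ+2c D m ⌈ d /2⌉ δ (bound v) ⟩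
  2 ℕ.* δ ℕ.+ 2 ℕ.* ⌈ d /2⌉        ≤⟨ NP.+-monoʳ-≤ (2 ℕ.* δ) (NP.≤-trans (2*⌈n/2⌉≤1+n d) (ℕ.s≤s d≤D)) ⟩
  2 ℕ.* δ ℕ.+ ℕ.suc D              ≡⟨ NP.+-suc (2 ℕ.* δ) D ⟩
  ℕ.suc (2 ℕ.* δ ℕ.+ D)            ≡⟨ cong ℕ.suc (NP.+-comm (2 ℕ.* δ) D) ⟩
  ℕ.suc (D ℕ.+ 2 ℕ.* δ)            ≡⟨ NP.+-suc D (2 ℕ.* δ) ⟨
  D ℕ.+ ℕ.suc (2 ℕ.* δ)            ∎))
  where
  open NP.≤-Reasoning
  D = deg G v
  δ = degIn G M v

theorem16 : ∀ {n} (G : Graph n) (d : ℕ) → IsMinDegree G d →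
    (k : ℤ) → + 1 - + ⌈ d /2⌉ ≤ k → k ≤ + ⌊ d /2⌋ →
    (r : ℕ) → 2 ≤ℕ r →
    (part : Fin n → Fin r) → Surjective _≡_ _≡_ part →
    (∀ i → IsMonopoly G k (tabulate (λ v → ⌊ part v ≟ i ⌋))) →
    (+ r ≤ + 2 - + 2 * k) × (k ≤ + 0)
theorem16 G d ((v , deg-v≡d) , _) k 1-c≤k _ r 2≤r part _ monopoly
  with 1-c≤k⇒k≡m-c ⌈ d /2⌉ 1-c≤k
... | m , 1≤m , refl = r+2m≤2+2c⇒r≤2-2[m-c] r m ⌈ d /2⌉ r+2m≤2+2c , i≤j⇒i-j≤0 (+≤+ m≤c)
  where
  r*m≤d : r ℕ.* m ≤ℕ d
  r*m≤d = subst (r ℕ.* m ≤ℕ_) (trans (∑-∣∩fiber∣ part (N G v)) deg-v≡d)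
            (*≤∑ _ (λ i → monopoly⇒m≤degIn G (monopoly i) (NP.≤-reflexive (sym deg-v≡d))))
  r*m≤2*c : r ℕ.* m ≤ℕ 2 ℕ.* ⌈ d /2⌉
  r*m≤2*c = NP.≤-trans r*m≤d (n≤2*⌈n/2⌉ d)
  m≤c : m ≤ℕ ⌈ d /2⌉
  m≤c = r*m≤2*c⇒m≤c ⌈ d /2⌉ 2≤r r*m≤2*c
  r+2m≤2+2c : r ℕ.+ 2 ℕ.* m ≤ℕ 2 ℕ.+ 2 ℕ.* ⌈ d /2⌉
  r+2m≤2+2c = r*m≤2*c⇒r+2*m≤2+2*c ⌈ d /2⌉ 2≤r 1≤m r*m≤2*c
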